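{- Let $p\in(0,1)$ and let $(X_t^S)$, $(X_t^D)$ be the SARPZF and DARPZF Markov chains with reversion probability $p$ on the star $K_{1,n-1}$ with universal (center) vertex $v$, with $X_t$ the number of blue vertices. If at time $t=0$ there are $b$ blue vertices and $v$ is blue, then \[\mathbf{E}_b[X_1^S]=(1-p)\left(b+(n-b)\frac{b}{n-1}\right)\quad\text{and}\quad\mathbf{E}_b[X_1^D]=\mathbf{E}_b[X_1^S]+np\left(\frac{b}{n-1}\right)^{n-b}.\]
   Context: On a graph with blue set $B$, SARPZF with reversion probability $p$: Phase 1: each blue vertex $u$ independently attempts to force each white neighbor $w$ with success probability $|N[u]\cap B|/\deg u$ ($N[u]$ closed neighborhood); a white vertex becomes blue if some attempt succeeds, giving $B'$. Phase 2: each vertex of $B'$ independently turns white with probability $p$. DARPZF is identical except no reversion when $B'$ is the whole vertex set. $\mathbf{E}_b$ denotes expectation from the given initial coloring.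
   Formalization: The reversion probability p ranges only over the rationals in (0,1). -}

module Defs where

open import Data.Bool using (Bool; true; false; _∧_; _∨_; not; if_then_else_)
open import Data.Nat as ℕ using (ℕ; zero; suc)
open import Data.Integer using (+_)
open import Data.Fin using (Fin; zero; suc)
open import Data.Fin.Properties using (_≟_)
open import Data.List using (List; []; _∷_; map; filter; concatMap; length; foldr)
open import Data.List using (allFin)
open import Data.Product using (_×_; _,_; proj₁; proj₂)
open import Relation.Nullary.Decidable using (does; ⌊_⌋)
open import Relation.Unary using (Decidable)
open import Data.Rational using (ℚ; 0ℚ; 1ℚ; _+_; _*_; _-_; _/_)

count : {n : ℕ} → (Fin n → Bool) → ℕ
count {n} f = length (filter (λ x → Data.Bool._≟_ (f x) true) (allFin n))

ℕ→ℚ : ℕ → ℚ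
ℕ→ℚ k = + k / 1

-- a / d as a rational; convention 0 when d = 0 (never used with d = 0 in the lemma)
_//_ : ℕ → ℕ → ℚ
a // zero = 0ℚ
a // suc d = + a / suc d

_^ℚ_ : ℚ → ℕ → ℚ
q ^ℚ zero = 1ℚ
q ^ℚ suc k = q * (q ^ℚ k)

-- Expectation of f over a vector of independent Bernoulli trials,
-- the i-th trial succeeding (true) with probability qs[i].
bernE : List ℚ → (List Bool → ℚ) → ℚ
bernE [] f = f []
bernE (q ∷ qs) f =
  q * bernE qs (λ bs → f (true ∷ bs)) + (1ℚ - q) * bernE qs (λ bs → f (false ∷ bs))

Graph : ℕ → Set
Graph n = Fin n → Fin n → Bool

Coloring : ℕ → Set
Coloring n = Fin n → Bool   -- true = blue

eqᵇ : {n : ℕ} → Fin n → Fin n → Bool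
eqᵇ x y = does (x ≟ y)

deg : {n : ℕ} → Graph n → Fin n → ℕ
deg G u = count (G u)

closedBlue : {n : ℕ} → Graph n → Coloring n → Fin n → ℕ
closedBlue G B u = count (λ x → (eqᵇ x u ∨ G u x) ∧ B x)

forceProb : {n : ℕ} → Graph n → Coloring n → Fin n → ℚ
forceProb G B u = closedBlue G B u // deg G u

attempts : {n : ℕ} → Graph n → Coloring n → List (Fin n × Fin n)
attempts {n} G B =
  filter (λ uw → Data.Bool._≟_ (B (proj₁ uw) ∧ not (B (proj₂ uw)) ∧ G (proj₁ uw) (proj₂ uw)) true)
         (concatMap (λ u → map (λ w → (u , w)) (allFin n)) (allFin n))

-- given outcomes of the attempts (aligned list), is w the target of a successful one?
hit : {n : ℕ} → Fin n → List (Fin n × Fin n) → List Bool → Bool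
hit w [] _ = false
hit w (_ ∷ _) [] = false
hit w ((u , w') ∷ as) (b ∷ bs) = (b ∧ eqᵇ w w') ∨ hit w as bs

phase1 : {n : ℕ} → Graph n → Coloring n → List Bool → Coloring n
phase1 G B outcomes w = B w ∨ hit w (attempts G B) outcomes

-- Phase 2: every vertex of B' independently turns white with probability p;
-- returns the expected number of blue vertices afterwards.
-- Trials are indexed by all vertices; a vertex outside B' gets a trial of
-- probability 0 (which never affects anything).
reverted : {n : ℕ} → List (Fin n) → List Bool → Coloring n
reverted [] _ x = false
reverted (_ ∷ _) [] x = false
reverted (v ∷ vs) (r ∷ rs) x = (r ∧ eqᵇ x v) ∨ reverted vs rs x

phase2E : {n : ℕ} → ℚ → Coloring n → ℚ
phase2E {n} p B' =
  bernE (map (λ x → if B' x then p else 0ℚ) (allFin n))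
        (λ rs → ℕ→ℚ (count (λ x → B' x ∧ not (reverted (allFin n) rs x))))

allBlue : {n : ℕ} → Coloring n → Bool
allBlue {n} B = foldr _∧_ true (map B (allFin n))

E-SARPZF : {n : ℕ} → ℚ → Graph n → Coloring n → ℚ
E-SARPZF p G B =
  bernE (map (λ uw → forceProb G B (proj₁ uw)) (attempts G B))
        (λ outs → phase2E p (phase1 G B outs))

-- E_B[X_1] for DARPZF: no reversion when B' is the whole vertex set
E-DARPZF : {n : ℕ} → ℚ → Graph n → Coloring n → ℚ
E-DARPZF {n} p G B =
  bernE (map (λ uw → forceProb G B (proj₁ uw)) (attempts G B))
        (λ outs → let B' = phase1 G B outs in
                  if allBlue B' then ℕ→ℚ n else phase2E p B')

star : (n : ℕ) → Graph n
star n zero zero = false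
star n zero (suc _) = true
star n (suc _) zero = true
star n (suc _) (suc _) = false

-- On the star centred at the blue vertex v every leaf is adjacent only to v, so v is the only
-- vertex that can force, and it forces each of the n - b white leaves independently with the same
-- probability q = |N[v] ∩ B| / deg v = b / (n - 1).  Hence |B'| = b + Binomial(n - b, q), giving
-- E|B'| = b + (n - b) q, and B' is the whole vertex set with probability q ^ (n - b).  Phase 2
-- keeps each vertex of B' independently with probability 1 - p, so by linearity
-- E[X₁] = (1 - p) E|B'|.  DARPZF differs from SARPZF only on the event B' = V, where it yields
-- n instead of the expected (1 - p) n, a gain of n p.
module Submission where

open import Defs
open import Data.Nat using (ℕ; suc; _≤_; _∸_)
import Data.Nat as ℕ
open import Data.Bool using (true)
open import Data.Fin using (zero)
open import Data.Rational using (ℚ; 0ℚ; 1ℚ; _<_; _+_; _*_; _-_)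
open import Relation.Binary.PropositionalEquality using (_≡_)
open import Data.Product using (_×_)

open import Data.Bool as Bool using (Bool; false; _∧_; _∨_; not; if_then_else_)
open import Data.Bool.Properties
  using (not-¬; not-injective; ∧-conicalˡ; ∧-conicalʳ; ∨-conicalˡ; ∨-conicalʳ; ∧-identityʳ; ∧-zeroʳ; ∨-assoc; ∨-identityʳ; ∨-zeroʳ)
open import Data.Fin as Fin using (Fin)
import Data.Integer as ℤ
open import Data.Integer using (+_)
import Data.Integer.Properties as ℤₚ
open import Data.List using (List; []; _∷_; _++_; map; filter; foldr; length; allFin; tabulate; concatMap)
open import Data.List.Properties using (filter-++; filter-none; filter-≐; map-∘; ++-identityʳ; length-tabulate)
open import Data.List.Membership.Propositional using (_∈_)
open import Data.List.Membership.Propositional.Properties using (∈-allFin; ∈-filter⁺)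
open import Data.List.Relation.Unary.All as All using (All; []; _∷_)
import Data.List.Relation.Unary.All.Properties as All
open import Data.List.Relation.Unary.Any using (here; there)
open import Data.List.Relation.Unary.Unique.Propositional using (Unique; []; _∷_)
open import Data.List.Relation.Unary.Unique.Propositional.Properties using (allFin⁺; filter⁺)
import Data.Nat.Coprimality as Coprime
open import Data.Nat.Properties using (+-suc; m+n∸m≡n)
open import Data.Product using (_,_; proj₁)
open import Data.Rational using (mkℚ)
open import Data.Rational.Properties using (normalize-coprime; *-comm)
open import Data.Rational.Solver using (module +-*-Solver)
open import Function using (_∘_)
open import Relation.Nullary using (¬_; Dec; yes; no)
open import Relation.Nullary.Decidable using (dec-true; dec-false)
open import Relation.Binary.PropositionalEquality
  using (_≢_; refl; sym; trans; cong; cong₂; ≢-sym; module ≡-Reasoning)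

open +-*-Solver using (solve; _:+_; _:*_; _:-_; _:=_; con)
open ≡-Reasoning

private
  variable
    A X : Set
    n : ℕ

ℕ→ℚ-suc : ∀ m → ℕ→ℚ (suc m) ≡ 1ℚ + ℕ→ℚ m
ℕ→ℚ-suc m = begin
  + suc m / 1                                ≡⟨ cong (λ i → (+ 1 ℤ.+ i) / 1) (sym (ℤₚ.*-identityʳ (+ m))) ⟩
  1ℚ + mkℚ (+ m) 0 coprime                   ≡⟨ cong (λ z → 1ℚ + z) (sym (normalize-coprime coprime)) ⟩
  1ℚ + ℕ→ℚ m                                 ∎
  where
  open Data.Rational using (_/_)
  coprime : Coprime.Coprime m 1
  coprime = Coprime.sym (Coprime.1-coprimeTo m)

countIn : List A → (A → Bool) → ℕ
countIn xs f = length (filter (λ x → f x Bool.≟ true) xs)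

toℕ : Bool → ℕ
toℕ false = 0
toℕ true  = 1

countIn-∷ : (f : A → Bool) (x : A) (xs : List A) → countIn (x ∷ xs) f ≡ toℕ (f x) ℕ.+ countIn xs f
countIn-∷ f x xs with f x
... | true  = refl
... | false = refl

countIn-cong : {f g : A → Bool} {xs : List A} → All (λ x → f x ≡ g x) xs → countIn xs f ≡ countIn xs g
countIn-cong [] = refl
countIn-cong {f = f} {g} {x ∷ xs} (fx≡gx ∷ eqs) = begin
  countIn (x ∷ xs) f          ≡⟨ countIn-∷ f x xs ⟩
  toℕ (f x) ℕ.+ countIn xs f  ≡⟨ cong₂ ℕ._+_ (cong toℕ fx≡gx) (countIn-cong eqs) ⟩
  toℕ (g x) ℕ.+ countIn xs g  ≡⟨ sym (countIn-∷ g x xs) ⟩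
  countIn (x ∷ xs) g          ∎

countIn-all : {f : A → Bool} {xs : List A} → All (λ x → f x ≡ true) xs → countIn xs f ≡ length xs
countIn-all [] = refl
countIn-all {f = f} {x ∷ xs} (fx ∷ fxs) =
  trans (countIn-∷ f x xs) (cong₂ ℕ._+_ (cong toℕ fx) (countIn-all fxs))

countIn-+-countIn-not : (f : A → Bool) (xs : List A) →
  countIn xs f ℕ.+ countIn xs (not ∘ f) ≡ length xs
countIn-+-countIn-not f [] = refl
countIn-+-countIn-not f (x ∷ xs) rewrite countIn-∷ f x xs | countIn-∷ (not ∘ f) x xs with f x
... | true  = cong suc (countIn-+-countIn-not f xs)
... | false = trans (+-suc (countIn xs f) _) (cong suc (countIn-+-countIn-not f xs))

filter-map : (f : A → X) (P : X → Bool) (xs : List A) →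
  filter (λ y → P y Bool.≟ true) (map f xs) ≡ map f (filter (λ x → P (f x) Bool.≟ true) xs)
filter-map f P []       = refl
filter-map f P (x ∷ xs) with P (f x)
... | true  = cong (f x ∷_) (filter-map f P xs)
... | false = filter-map f P xs

eqᵇ-refl : (v : Fin n) → eqᵇ v v ≡ true
eqᵇ-refl v = dec-true (v Fin.≟ v) refl

eqᵇ-≢ : {x v : Fin n} → x ≢ v → eqᵇ x v ≡ false
eqᵇ-≢ {x = x} {v} = dec-false (x Fin.≟ v)

eqᵇ-true⇒≡ : (x v : Fin n) → eqᵇ x v ≡ true → x ≡ v
eqᵇ-true⇒≡ x v with x Fin.≟ v
... | yes x≡v = λ _ → x≡v
... | no _    = λ ()

_∖_ : Coloring n → Fin n → Coloring n
(g ∖ v) x = g x ∧ not (eqᵇ x v)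

_∪｛_｝ : Coloring n → Fin n → Coloring n
(g ∪｛ v ｝) x = g x ∨ eqᵇ x v

∖-≢ : (g : Coloring n) {x v : Fin n} → x ≢ v → (g ∖ v) x ≡ g x
∖-≢ g {x} x≢v = trans (cong (λ e → g x ∧ not e) (eqᵇ-≢ x≢v)) (∧-identityʳ (g x))

∪-≢ : (g : Coloring n) {x v : Fin n} → x ≢ v → (g ∪｛ v ｝) x ≡ g x
∪-≢ g {x} x≢v = trans (cong (g x ∨_) (eqᵇ-≢ x≢v)) (∨-identityʳ (g x))

∖-absent : (g : Coloring n) {v : Fin n} → g v ≡ false → ∀ x → (g ∖ v) x ≡ g x
∖-absent g {v} gv x with eqᵇ x v in e
... | false = ∧-identityʳ (g x)
... | true rewrite eqᵇ-true⇒≡ x v e = trans (∧-zeroʳ (g v)) (sym gv)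

∪∖-absent : (g : Coloring n) {v : Fin n} → g v ≡ false → ∀ x → ((g ∪｛ v ｝) ∖ v) x ≡ g x
∪∖-absent g {v} gv x with eqᵇ x v in e
... | false = trans (∧-identityʳ _) (∨-identityʳ (g x))
... | true rewrite eqᵇ-true⇒≡ x v e = trans (∧-zeroʳ _) (sym gv)

countIn-remove : (g : Coloring n) {v : Fin n} {xs : List (Fin n)} → Unique xs → v ∈ xs →
  g v ≡ true → countIn xs g ≡ suc (countIn xs (g ∖ v))
countIn-remove g {v} {.v ∷ xs} (v≢xs ∷ _) (here refl) gv = begin
  countIn (v ∷ xs) g
    ≡⟨ countIn-∷ g v xs ⟩
  toℕ (g v) ℕ.+ countIn xs g
    ≡⟨ cong₂ ℕ._+_ (cong toℕ gv) (countIn-cong (All.map (sym ∘ ∖-≢ g ∘ ≢-sym) v≢xs)) ⟩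
  suc (countIn xs (g ∖ v))
    ≡⟨ cong (λ b → suc (toℕ b ℕ.+ countIn xs (g ∖ v))) (sym v-removed) ⟩
  suc (toℕ ((g ∖ v) v) ℕ.+ countIn xs (g ∖ v))
    ≡⟨ cong suc (sym (countIn-∷ (g ∖ v) v xs)) ⟩
  suc (countIn (v ∷ xs) (g ∖ v))
    ∎
  where
  v-removed : (g ∖ v) v ≡ false
  v-removed = trans (cong (λ e → g v ∧ not e) (eqᵇ-refl v)) (∧-zeroʳ (g v))
countIn-remove g {v} {x ∷ xs} (x≢xs ∷ u) (there v∈xs) gv = begin
  countIn (x ∷ xs) g
    ≡⟨ countIn-∷ g x xs ⟩
  toℕ (g x) ℕ.+ countIn xs g
    ≡⟨ cong₂ ℕ._+_ (cong toℕ (sym (∖-≢ g x≢v))) (countIn-remove g u v∈xs gv) ⟩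
  toℕ ((g ∖ v) x) ℕ.+ suc (countIn xs (g ∖ v))
    ≡⟨ +-suc _ _ ⟩
  suc (toℕ ((g ∖ v) x) ℕ.+ countIn xs (g ∖ v))
    ≡⟨ cong suc (sym (countIn-∷ (g ∖ v) x xs)) ⟩
  suc (countIn (x ∷ xs) (g ∖ v))
    ∎
  where
  x≢v : x ≢ v
  x≢v = All.lookup x≢xs v∈xs

count-remove : (g : Coloring n) {v : Fin n} → g v ≡ true → count g ≡ suc (count (g ∖ v))
count-remove {n} g {v} = countIn-remove g (allFin⁺ n) (∈-allFin v)

count-insert : (g : Coloring n) {v : Fin n} → g v ≡ false → count (g ∪｛ v ｝) ≡ suc (count g)
count-insert g {v} gv = begin
  count (g ∪｛ v ｝)               ≡⟨ count-remove (g ∪｛ v ｝) v-added ⟩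
  suc (count ((g ∪｛ v ｝) ∖ v))   ≡⟨ cong suc (countIn-cong (All.universal (∪∖-absent g gv) (allFin _))) ⟩
  suc (count g)                  ∎
  where
  v-added : (g ∪｛ v ｝) v ≡ true
  v-added = trans (cong (g v ∨_) (eqᵇ-refl v)) (∨-zeroʳ (g v))

count-full : (g : Coloring n) → (∀ x → g x ≡ true) → count g ≡ n
count-full {n} g all-true = trans (countIn-all (All.universal all-true (allFin n))) (length-tabulate {n = n} (λ x → x))

and-map-cong : {f g : A → Bool} (xs : List A) → (∀ x → f x ≡ g x) →
  foldr _∧_ true (map f xs) ≡ foldr _∧_ true (map g xs)
and-map-cong [] f≗g = refl
and-map-cong (x ∷ xs) f≗g = cong₂ _∧_ (f≗g x) (and-map-cong xs f≗g)

and-map-true : {f : A → Bool} (xs : List A) → (∀ x → f x ≡ true) → foldr _∧_ true (map f xs) ≡ true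
and-map-true [] all-true = refl
and-map-true (x ∷ xs) all-true rewrite all-true x = and-map-true xs all-true

and-map-false : {f : A → Bool} {x : A} {xs : List A} → x ∈ xs → f x ≡ false →
  foldr _∧_ true (map f xs) ≡ false
and-map-false (here refl) fx rewrite fx = refl
and-map-false {f = f} {xs = y ∷ _} (there x∈xs) fx =
  trans (cong (f y ∧_) (and-map-false {f = f} x∈xs fx)) (∧-zeroʳ (f y))

and-map-true⇒ : {f : A → Bool} (xs : List A) → foldr _∧_ true (map f xs) ≡ true → All (λ x → f x ≡ true) xs
and-map-true⇒ [] _ = []
and-map-true⇒ {f = f} (x ∷ xs) all-true =
  ∧-conicalˡ (f x) _ all-true ∷ and-map-true⇒ xs (∧-conicalʳ (f x) _ all-true)

allBlue-cong : {f g : Coloring n} → (∀ x → f x ≡ g x) → allBlue f ≡ allBlue g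
allBlue-cong = and-map-cong (allFin _)

allBlue-true : {g : Coloring n} → (∀ x → g x ≡ true) → allBlue g ≡ true
allBlue-true = and-map-true (allFin _)

allBlue-false : {g : Coloring n} (x : Fin n) → g x ≡ false → allBlue g ≡ false
allBlue-false x = and-map-false (∈-allFin x)

allBlue⇒blue : {g : Coloring n} → allBlue g ≡ true → ∀ x → g x ≡ true
allBlue⇒blue all-blue x = All.lookup (and-map-true⇒ (allFin _) all-blue) (∈-allFin x)

bernE-cong : (qs : List ℚ) {f g : List Bool → ℚ} → (∀ bs → f bs ≡ g bs) → bernE qs f ≡ bernE qs g
bernE-cong []       f≗g = f≗g []
bernE-cong (q ∷ qs) f≗g = cong₂ (λ a b → q * a + (1ℚ - q) * b)
  (bernE-cong qs (f≗g ∘ (true ∷_))) (bernE-cong qs (f≗g ∘ (false ∷_)))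

convex-same : ∀ q c → q * c + (1ℚ - q) * c ≡ c
convex-same = solve 2 (λ q c → q :* c :+ (con 1ℚ :- q) :* c := c) refl

bernE-const : (qs : List ℚ) (c : ℚ) → bernE qs (λ _ → c) ≡ c
bernE-const []       c = refl
bernE-const (q ∷ qs) c rewrite bernE-const qs c = convex-same q c

bernE-*ˡ : (qs : List ℚ) (c : ℚ) (f : List Bool → ℚ) → bernE qs (λ bs → c * f bs) ≡ c * bernE qs f
bernE-*ˡ []       c f = refl
bernE-*ˡ (q ∷ qs) c f
  rewrite bernE-*ˡ qs c (f ∘ (true ∷_)) | bernE-*ˡ qs c (f ∘ (false ∷_)) = distrib q c _ _
  where
  distrib : ∀ q c a b → q * (c * a) + (1ℚ - q) * (c * b) ≡ c * (q * a + (1ℚ - q) * b)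
  distrib = solve 4 (λ q c a b → q :* (c :* a) :+ (con 1ℚ :- q) :* (c :* b)
                                 := c :* (q :* a :+ (con 1ℚ :- q) :* b)) refl

bernE-+ : (qs : List ℚ) (f g : List Bool → ℚ) → bernE qs (λ bs → f bs + g bs) ≡ bernE qs f + bernE qs g
bernE-+ []       f g = refl
bernE-+ (q ∷ qs) f g
  rewrite bernE-+ qs (f ∘ (true ∷_)) (g ∘ (true ∷_)) | bernE-+ qs (f ∘ (false ∷_)) (g ∘ (false ∷_)) =
  distrib q _ _ _ _
  where
  distrib : ∀ q a b c d → q * (a + c) + (1ℚ - q) * (b + d) ≡ (q * a + (1ℚ - q) * b) + (q * c + (1ℚ - q) * d)
  distrib = solve 5 (λ q a b c d → q :* (a :+ c) :+ (con 1ℚ :- q) :* (b :+ d)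
                                   := (q :* a :+ (con 1ℚ :- q) :* b) :+ (q :* c :+ (con 1ℚ :- q) :* d)) refl

∧-not-∨ : ∀ a e r → a ∧ not (e ∨ r) ≡ (a ∧ not e) ∧ not r
∧-not-∨ a true  r rewrite ∧-zeroʳ a = refl
∧-not-∨ a false r = cong (_∧ not r) (sym (∧-identityʳ a))

-- Stated for any g ⊆ B' so that the induction can drop a reverted vertex from g.
expected-unreverted : (p : ℚ) (B' g : Coloring n) {vs : List (Fin n)} → Unique vs →
  (∀ x → g x ≡ true → B' x ≡ true) →
  bernE (map (λ x → if B' x then p else 0ℚ) vs) (λ rs → ℕ→ℚ (count (λ x → g x ∧ not (reverted vs rs x))))
    ≡ ℕ→ℚ (count g) - p * ℕ→ℚ (countIn vs g)
expected-unreverted p B' g [] g⊆B' = begin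
  ℕ→ℚ (count (λ x → g x ∧ true)) ≡⟨ cong ℕ→ℚ (countIn-cong (All.universal (∧-identityʳ ∘ g) (allFin _))) ⟩
  ℕ→ℚ (count g)                  ≡⟨ solve 2 (λ c p → c := c :- p :* con 0ℚ) refl (ℕ→ℚ (count g)) p ⟩
  ℕ→ℚ (count g) - p * 0ℚ         ∎
expected-unreverted p B' g {v ∷ vs} (v≢vs ∷ vs-unique) g⊆B' = by-colour (g v) refl
  where
  trials : List ℚ
  trials = map (λ x → if B' x then p else 0ℚ) vs
  w : ℚ
  w = if B' v then p else 0ℚ

  v-reverted : bernE trials (λ rs → ℕ→ℚ (count (λ x → g x ∧ not (eqᵇ x v ∨ reverted vs rs x))))
             ≡ ℕ→ℚ (count (g ∖ v)) - p * ℕ→ℚ (countIn vs (g ∖ v))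
  v-reverted = trans
    (bernE-cong trials (λ rs → cong ℕ→ℚ (countIn-cong (All.universal (λ x → ∧-not-∨ (g x) _ _) (allFin _)))))
    (expected-unreverted p B' (g ∖ v) vs-unique (λ x e → g⊆B' x (∧-conicalˡ (g x) _ e)))

  vs-unaffected : countIn vs (g ∖ v) ≡ countIn vs g
  vs-unaffected = countIn-cong (All.map (∖-≢ g ∘ ≢-sym) v≢vs)

  by-colour : (b : Bool) → g v ≡ b →
    w * bernE trials (λ rs → ℕ→ℚ (count (λ x → g x ∧ not (eqᵇ x v ∨ reverted vs rs x))))
    + (1ℚ - w) * bernE trials (λ rs → ℕ→ℚ (count (λ x → g x ∧ not (reverted vs rs x))))
      ≡ ℕ→ℚ (count g) - p * ℕ→ℚ (countIn (v ∷ vs) g)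
  by-colour true gv = begin
    w * _ + (1ℚ - w) * _
      ≡⟨ cong₂ (λ a b → w * a + (1ℚ - w) * b) v-reverted (expected-unreverted p B' g vs-unique g⊆B') ⟩
    w * (C - p * K′) + (1ℚ - w) * (ℕ→ℚ (count g) - p * K)
      ≡⟨ cong₂ (λ w′ k′ → w′ * (C - p * k′) + (1ℚ - w′) * (ℕ→ℚ (count g) - p * K))
               (cong (λ b → if b then p else 0ℚ) (g⊆B' v gv)) (cong ℕ→ℚ vs-unaffected) ⟩
    p * (C - p * K) + (1ℚ - p) * (ℕ→ℚ (count g) - p * K)
      ≡⟨ cong (λ c → p * (C - p * K) + (1ℚ - p) * (c - p * K)) count-g ⟩
    p * (C - p * K) + (1ℚ - p) * ((1ℚ + C) - p * K)
      ≡⟨ solve 3 (λ p c k → p :* (c :- p :* k) :+ (con 1ℚ :- p) :* ((con 1ℚ :+ c) :- p :* k)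
                            := (con 1ℚ :+ c) :- p :* (con 1ℚ :+ k)) refl p C K ⟩
    (1ℚ + C) - p * (1ℚ + K)
      ≡⟨ cong₂ (λ c k → c - p * k) (sym count-g) (sym countIn-g) ⟩
    ℕ→ℚ (count g) - p * ℕ→ℚ (countIn (v ∷ vs) g)
      ∎
    where
    C K K′ : ℚ
    C = ℕ→ℚ (count (g ∖ v))
    K = ℕ→ℚ (countIn vs g)
    K′ = ℕ→ℚ (countIn vs (g ∖ v))
    count-g : ℕ→ℚ (count g) ≡ 1ℚ + C
    count-g = trans (cong ℕ→ℚ (count-remove g gv)) (ℕ→ℚ-suc (count (g ∖ v)))
    countIn-g : ℕ→ℚ (countIn (v ∷ vs) g) ≡ 1ℚ + K
    countIn-g = trans (cong ℕ→ℚ (trans (countIn-∷ g v vs) (cong (λ b → toℕ b ℕ.+ countIn vs g) gv)))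
                      (ℕ→ℚ-suc (countIn vs g))
  by-colour false gv = begin
    w * _ + (1ℚ - w) * _
      ≡⟨ cong₂ (λ a b → w * a + (1ℚ - w) * b) (trans v-reverted v-was-white)
               (expected-unreverted p B' g vs-unique g⊆B') ⟩
    w * R + (1ℚ - w) * R
      ≡⟨ convex-same w R ⟩
    R
      ≡⟨ cong (λ k → ℕ→ℚ (count g) - p * ℕ→ℚ k) (sym countIn-g) ⟩
    ℕ→ℚ (count g) - p * ℕ→ℚ (countIn (v ∷ vs) g)
      ∎
    where
    R : ℚ
    R = ℕ→ℚ (count g) - p * ℕ→ℚ (countIn vs g)
    countIn-g : countIn (v ∷ vs) g ≡ countIn vs g
    countIn-g = trans (countIn-∷ g v vs) (cong (λ b → toℕ b ℕ.+ countIn vs g) gv)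
    v-was-white : ℕ→ℚ (count (g ∖ v)) - p * ℕ→ℚ (countIn vs (g ∖ v)) ≡ R
    v-was-white = cong₂ (λ c k → ℕ→ℚ c - p * ℕ→ℚ k)
      (countIn-cong (All.universal (∖-absent g gv) (allFin _))) vs-unaffected

phase2E≡ : (p : ℚ) (B' : Coloring n) → phase2E p B' ≡ (1ℚ - p) * ℕ→ℚ (count B')
phase2E≡ {n} p B' = trans (expected-unreverted p B' B' (allFin⁺ n) (λ _ e → e))
  (solve 2 (λ c p → c :- p :* c := (con 1ℚ :- p) :* c) refl (ℕ→ℚ (count B')) p)

expected-count-after-forcing : (q : ℚ) (c : Fin n) (g : Coloring n) {W : List (Fin n)} → Unique W →
  All (λ w → g w ≡ false) W →
  bernE (map (λ _ → q) W) (λ outs → ℕ→ℚ (count (λ w → g w ∨ hit w (map (c ,_) W) outs)))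
    ≡ ℕ→ℚ (count g) + q * ℕ→ℚ (length W)
expected-count-after-forcing q c g [] _ = begin
  ℕ→ℚ (count (λ w → g w ∨ false)) ≡⟨ cong ℕ→ℚ (countIn-cong (All.universal (∨-identityʳ ∘ g) (allFin _))) ⟩
  ℕ→ℚ (count g)                  ≡⟨ solve 2 (λ c q → c := c :+ q :* con 0ℚ) refl (ℕ→ℚ (count g)) q ⟩
  ℕ→ℚ (count g) + q * 0ℚ         ∎
expected-count-after-forcing q c g {w′ ∷ W} (w′≢W ∷ W-unique) (gw′ ∷ gW) = begin
  q * _ + (1ℚ - q) * _
    ≡⟨ cong₂ (λ a b → q * a + (1ℚ - q) * b) w′-forced (expected-count-after-forcing q c g W-unique gW) ⟩
  q * (ℕ→ℚ (count (g ∪｛ w′ ｝)) + q * L) + (1ℚ - q) * (G + q * L)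
    ≡⟨ cong (λ a → q * (a + q * L) + (1ℚ - q) * (G + q * L))
            (trans (cong ℕ→ℚ (count-insert g gw′)) (ℕ→ℚ-suc (count g))) ⟩
  q * ((1ℚ + G) + q * L) + (1ℚ - q) * (G + q * L)
    ≡⟨ solve 3 (λ q c l → q :* ((con 1ℚ :+ c) :+ q :* l) :+ (con 1ℚ :- q) :* (c :+ q :* l)
                          := c :+ q :* (con 1ℚ :+ l)) refl q G L ⟩
  G + q * (1ℚ + L)
    ≡⟨ cong (λ l → G + q * l) (sym (ℕ→ℚ-suc (length W))) ⟩
  G + q * ℕ→ℚ (suc (length W))
    ∎
  where
  G L : ℚ
  G = ℕ→ℚ (count g)
  L = ℕ→ℚ (length W)
  w′-forced : bernE (map (λ _ → q) W)
                (λ outs → ℕ→ℚ (count (λ w → g w ∨ (eqᵇ w w′ ∨ hit w (map (c ,_) W) outs))))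
            ≡ ℕ→ℚ (count (g ∪｛ w′ ｝)) + q * L
  w′-forced = trans
    (bernE-cong (map (λ _ → q) W) (λ outs →
      cong ℕ→ℚ (countIn-cong (All.universal (λ w → sym (∨-assoc (g w) _ _)) (allFin _)))))
    (expected-count-after-forcing q c (g ∪｛ w′ ｝) W-unique
      (All.zipWith (λ (w′≢w , gw) → trans (∪-≢ g (≢-sym w′≢w)) gw) (w′≢W , gW)))

hit-∉ : (c w : Fin n) (W : List (Fin n)) (outs : List Bool) → All (w ≢_) W → hit w (map (c ,_) W) outs ≡ false
hit-∉ c w []      outs       _             = refl
hit-∉ c w (_ ∷ _) []         _             = refl
hit-∉ c w (y ∷ W) (out ∷ outs) (w≢y ∷ w≢W) =
  cong₂ _∨_ (trans (cong (out ∧_) (eqᵇ-≢ w≢y)) (∧-zeroʳ out)) (hit-∉ c w W outs w≢W)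

all-blue-after-forcing : (q d : ℚ) (c : Fin n) (g : Coloring n) {W : List (Fin n)} → Unique W →
  All (λ w → g w ≡ false) W → (∀ x → g x ≡ false → x ∈ W) →
  bernE (map (λ _ → q) W) (λ outs → if allBlue (λ w → g w ∨ hit w (map (c ,_) W) outs) then d else 0ℚ)
    ≡ d * (q ^ℚ length W)
all-blue-after-forcing q d c g [] _ white⇒∈W = begin
  (if allBlue (λ w → g w ∨ false) then d else 0ℚ) ≡⟨ cong (λ b → if b then d else 0ℚ) (allBlue-true all-blue) ⟩
  d                                               ≡⟨ solve 1 (λ d → d := d :* con 1ℚ) refl d ⟩
  d * 1ℚ                                          ∎
  where
  all-blue : ∀ x → g x ∨ false ≡ true
  all-blue x with g x in gx
  ... | true  = refl
  ... | false with () ← white⇒∈W x gx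
all-blue-after-forcing q d c g {w′ ∷ W} (w′≢W ∷ W-unique) (gw′ ∷ gW) white⇒∈W = begin
  q * _ + (1ℚ - q) * _
    ≡⟨ cong₂ (λ a b → q * a + (1ℚ - q) * b) w′-forced w′-unforced ⟩
  q * (d * (q ^ℚ length W)) + (1ℚ - q) * 0ℚ
    ≡⟨ solve 3 (λ q d x → q :* (d :* x) :+ (con 1ℚ :- q) :* con 0ℚ := d :* (q :* x)) refl q d (q ^ℚ length W) ⟩
  d * (q ^ℚ suc (length W))
    ∎
  where
  white⇒∈W′ : ∀ x → (g ∪｛ w′ ｝) x ≡ false → x ∈ W
  white⇒∈W′ x gx with white⇒∈W x (∨-conicalˡ (g x) _ gx)
  ... | there x∈W = x∈W
  ... | here refl with () ← trans (sym (∨-conicalʳ (g x) _ gx)) (eqᵇ-refl x)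
  w′-forced : bernE (map (λ _ → q) W)
                (λ outs → if allBlue (λ w → g w ∨ (eqᵇ w w′ ∨ hit w (map (c ,_) W) outs)) then d else 0ℚ)
            ≡ d * (q ^ℚ length W)
  w′-forced = trans
    (bernE-cong (map (λ _ → q) W) (λ outs →
      cong (λ b → if b then d else 0ℚ) (allBlue-cong (λ w → sym (∨-assoc (g w) _ _)))))
    (all-blue-after-forcing q d c (g ∪｛ w′ ｝) W-unique
      (All.zipWith (λ (w′≢w , gw) → trans (∪-≢ g (≢-sym w′≢w)) gw) (w′≢W , gW)) white⇒∈W′)
  w′-unforced : bernE (map (λ _ → q) W) (λ outs → if allBlue (λ w → g w ∨ hit w (map (c ,_) W) outs) then d else 0ℚ)
              ≡ 0ℚ
  w′-unforced = trans
    (bernE-cong (map (λ _ → q) W) (λ outs →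
      cong (λ b → if b then d else 0ℚ) (allBlue-false w′ (cong₂ _∨_ gw′ (hit-∉ c w′ W outs w′≢W)))))
    (bernE-const (map (λ _ → q) W) 0ℚ)

attemptProbs : Graph n → Coloring n → List ℚ
attemptProbs G B = map (λ uw → forceProb G B (proj₁ uw)) (attempts G B)

phase1E : Graph n → Coloring n → (Coloring n → ℚ) → ℚ
phase1E G B h = bernE (attemptProbs G B) (λ outs → h (phase1 G B outs))

E-SARPZF≡ : (p : ℚ) (G : Graph n) (B : Coloring n) →
  E-SARPZF p G B ≡ (1ℚ - p) * phase1E G B (ℕ→ℚ ∘ count)
E-SARPZF≡ p G B = trans (bernE-cong (attemptProbs G B) (λ outs → phase2E≡ p (phase1 G B outs)))
                        (bernE-*ˡ (attemptProbs G B) (1ℚ - p) (λ outs → ℕ→ℚ (count (phase1 G B outs))))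

darpzf-outcome : (p : ℚ) (B' : Coloring n) →
  (if allBlue B' then ℕ→ℚ n else phase2E p B') ≡ phase2E p B' + (if allBlue B' then ℕ→ℚ n * p else 0ℚ)
darpzf-outcome {n} p B' = by-allBlue (allBlue B') refl
  where
  by-allBlue : (b : Bool) → allBlue B' ≡ b →
    (if b then ℕ→ℚ n else phase2E p B') ≡ phase2E p B' + (if b then ℕ→ℚ n * p else 0ℚ)
  by-allBlue true all-blue = begin
    ℕ→ℚ n                                ≡⟨ solve 2 (λ N p → N := (con 1ℚ :- p) :* N :+ N :* p) refl (ℕ→ℚ n) p ⟩
    (1ℚ - p) * ℕ→ℚ n + ℕ→ℚ n * p          ≡⟨ cong (λ m → (1ℚ - p) * ℕ→ℚ m + ℕ→ℚ n * p)
                                                     (sym (count-full B' (allBlue⇒blue all-blue))) ⟩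
    (1ℚ - p) * ℕ→ℚ (count B') + ℕ→ℚ n * p ≡⟨ cong (_+ ℕ→ℚ n * p) (sym (phase2E≡ p B')) ⟩
    phase2E p B' + ℕ→ℚ n * p              ∎
  by-allBlue false _ = solve 1 (λ x → x := x :+ con 0ℚ) refl (phase2E p B')

E-DARPZF≡ : (p : ℚ) (G : Graph n) (B : Coloring n) →
  E-DARPZF p G B ≡ E-SARPZF p G B + phase1E G B (λ B' → if allBlue B' then ℕ→ℚ n * p else 0ℚ)
E-DARPZF≡ p G B = trans (bernE-cong (attemptProbs G B) (λ outs → darpzf-outcome p (phase1 G B outs)))
                        (bernE-+ (attemptProbs G B) _ _)

module StarWithBlueCentre {k : ℕ} (B : Coloring (suc k)) (centre-blue : B zero ≡ true) where

  G : Graph (suc k)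
  G = star (suc k)

  b : ℕ
  b = count B

  white? : (w : Fin (suc k)) → Dec (not (B w) ≡ true)
  white? w = not (B w) Bool.≟ true

  whites : List (Fin (suc k))
  whites = filter white? (allFin (suc k))

  can-force : Fin (suc k) × Fin (suc k) → Bool
  can-force (u , w) = B u ∧ not (B w) ∧ G u w

  leaves-cannot-force : (u : Fin k) (w : Fin (suc k)) → ¬ (can-force (Fin.suc u , w) ≡ true)
  leaves-cannot-force u zero rewrite centre-blue = not-¬ (∧-zeroʳ (B (Fin.suc u)))
  leaves-cannot-force u (Fin.suc w) rewrite ∧-zeroʳ (not (B (Fin.suc w))) = not-¬ (∧-zeroʳ (B (Fin.suc u)))

  centre-forces-whites : (w : Fin (suc k)) → can-force (zero , w) ≡ not (B w)
  centre-forces-whites zero        rewrite centre-blue = refl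
  centre-forces-whites (Fin.suc w) rewrite centre-blue = ∧-identityʳ (not (B (Fin.suc w)))

  attempts-star : attempts G B ≡ map (zero ,_) whites
  attempts-star = begin
    -- attempts G B, with allFin (suc k) unfolded to zero ∷ tabulate suc
    filter can-force? (map (zero ,_) (allFin (suc k)) ++ concatMap leaf-pairs (tabulate Fin.suc))
      ≡⟨ filter-++ can-force? (map (zero ,_) (allFin (suc k))) _ ⟩
    filter can-force? (map (zero ,_) (allFin (suc k))) ++ filter can-force? (concatMap leaf-pairs (tabulate Fin.suc))
      ≡⟨ cong₂ _++_ (filter-map (zero ,_) can-force (allFin (suc k)))
                    (filter-none can-force? (All.concat⁺ (All.map⁺ (All.tabulate⁺ λ u →
                      All.map⁺ (All.universal (leaves-cannot-force u) (allFin (suc k))))))) ⟩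
    map (zero ,_) (filter (λ w → can-force (zero , w) Bool.≟ true) (allFin (suc k))) ++ []
      ≡⟨ ++-identityʳ _ ⟩
    map (zero ,_) (filter (λ w → can-force (zero , w) Bool.≟ true) (allFin (suc k)))
      ≡⟨ cong (map (zero ,_)) (filter-≐ (λ w → can-force (zero , w) Bool.≟ true) white?
                                 (trans (sym (centre-forces-whites _)) , trans (centre-forces-whites _))
                                 (allFin (suc k))) ⟩
    map (zero ,_) whites
      ∎
    where
    can-force? : (uw : Fin (suc k) × Fin (suc k)) → Dec (can-force uw ≡ true)
    can-force? uw = can-force uw Bool.≟ true
    leaf-pairs : Fin (suc k) → List (Fin (suc k) × Fin (suc k))
    leaf-pairs u = map (u ,_) (allFin (suc k))

  whites-unique : Unique whites
  whites-unique = filter⁺ white? (allFin⁺ (suc k))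

  whites-white : All (λ w → B w ≡ false) whites
  whites-white = All.map not-injective (All.all-filter white? (allFin (suc k)))

  whites-complete : ∀ x → B x ≡ false → x ∈ whites
  whites-complete x Bx = ∈-filter⁺ white? (∈-allFin x) (cong not Bx)

  length-whites : length whites ≡ suc k ∸ b
  length-whites = begin
    length whites              ≡⟨ sym (m+n∸m≡n b _) ⟩
    b ℕ.+ length whites ∸ b    ≡⟨ cong (_∸ b) (countIn-+-countIn-not B (allFin (suc k))) ⟩
    length (allFin (suc k)) ∸ b ≡⟨ cong (_∸ b) (length-tabulate {n = suc k} (λ x → x)) ⟩
    suc k ∸ b                  ∎

  q : ℚ
  q = forceProb G B zero

  q≡b//k : q ≡ b // k
  q≡b//k = cong₂ _//_ closedBlue-centre deg-centre
    where
    closedBlue-centre : closedBlue G B zero ≡ b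
    closedBlue-centre = countIn-cong (All.universal blue-in-N[v] (allFin (suc k)))
      where
      blue-in-N[v] : ∀ x → ((eqᵇ x zero ∨ G zero x) ∧ B x) ≡ B x
      blue-in-N[v] zero        = refl
      blue-in-N[v] (Fin.suc x) = refl
    deg-centre : deg G zero ≡ k
    deg-centre = trans (countIn-all {f = G zero} {xs = tabulate Fin.suc} (All.tabulate⁺ (λ _ → refl)))
                       (length-tabulate {n = k} Fin.suc)

  phase1E-star : (h : Coloring (suc k) → ℚ) →
    phase1E G B h ≡ bernE (map (λ _ → q) whites) (λ outs → h (λ w → B w ∨ hit w (map (zero ,_) whites) outs))
  phase1E-star h = begin
    bernE (map fp (attempts G B)) (λ outs → h (λ w → B w ∨ hit w (attempts G B) outs))
      ≡⟨ cong (λ as → bernE (map fp as) (λ outs → h (λ w → B w ∨ hit w as outs))) attempts-star ⟩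
    bernE (map fp (map (zero ,_) whites)) after-phase1
      ≡⟨ cong (λ qs → bernE qs after-phase1) (sym (map-∘ {g = fp} {f = zero ,_} whites)) ⟩
    bernE (map (λ _ → q) whites) after-phase1
      ∎
    where
    fp : Fin (suc k) × Fin (suc k) → ℚ
    fp uw = forceProb G B (proj₁ uw)
    after-phase1 : List Bool → ℚ
    after-phase1 outs = h (λ w → B w ∨ hit w (map (zero ,_) whites) outs)

  expected-phase1-count : phase1E G B (ℕ→ℚ ∘ count) ≡ ℕ→ℚ b + ℕ→ℚ (suc k ∸ b) * (b // k)
  expected-phase1-count = begin
    phase1E G B (ℕ→ℚ ∘ count)                ≡⟨ phase1E-star (ℕ→ℚ ∘ count) ⟩
    _                                        ≡⟨ expected-count-after-forcing q zero B whites-unique whites-white ⟩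
    ℕ→ℚ b + q * ℕ→ℚ (length whites)          ≡⟨ cong₂ (λ q′ l → ℕ→ℚ b + q′ * ℕ→ℚ l) q≡b//k length-whites ⟩
    ℕ→ℚ b + (b // k) * ℕ→ℚ (suc k ∸ b)       ≡⟨ cong (λ x → ℕ→ℚ b + x) (*-comm (b // k) _) ⟩
    ℕ→ℚ b + ℕ→ℚ (suc k ∸ b) * (b // k)       ∎

  probability-all-blue : (d : ℚ) →
    phase1E G B (λ B' → if allBlue B' then d else 0ℚ) ≡ d * ((b // k) ^ℚ (suc k ∸ b))
  probability-all-blue d = begin
    phase1E G B (λ B' → if allBlue B' then d else 0ℚ) ≡⟨ phase1E-star (λ B' → if allBlue B' then d else 0ℚ) ⟩
    _                                                ≡⟨ all-blue-after-forcing q d zero B whites-unique whites-white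
                                                                                whites-complete ⟩
    d * (q ^ℚ length whites)                         ≡⟨ cong₂ (λ q′ l → d * (q′ ^ℚ l)) q≡b//k length-whites ⟩
    d * ((b // k) ^ℚ (suc k ∸ b))                    ∎

-- Both identities hold for every p and also for k = 0.
lemma4p16 : (k : ℕ) → 1 ≤ k → let n = suc k in (p : ℚ) → 0ℚ < p → p < 1ℚ →
  (B : Coloring n) → B zero ≡ true →
  let b = count B in
  (E-SARPZF p (star n) B ≡ (1ℚ - p) * (ℕ→ℚ b + ℕ→ℚ (n ∸ b) * (b // (n ∸ 1))))
  × (E-DARPZF p (star n) B ≡ E-SARPZF p (star n) B + ℕ→ℚ n * p * ((b // (n ∸ 1)) ^ℚ (n ∸ b)))
lemma4p16 k _ p _ _ B centre-blue =
  trans (E-SARPZF≡ p G B) (cong ((1ℚ - p) *_) expected-phase1-count) ,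
  trans (E-DARPZF≡ p G B) (cong (λ x → E-SARPZF p G B + x) (probability-all-blue (ℕ→ℚ (suc k) * p)))
  where open StarWithBlueCentre B centre-blue
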